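{- Let $n\ge2$, $m\ge1$ with $m\le n$. Then $\operatorname{ecc}_{Z_{n,m}}(0)=\lfloor\frac{n(m+1)}{2}\rfloor$, where $\operatorname{ecc}_{Z_{n,m}}(0)$ is the maximum graph distance in $Z_{n,m}$ from the all-zero vertex $0$ to a vertex.
   Context: Elements of $\mathbb{Z}_n$ are identified with their smallest nonnegative representatives in $\{0,\dots,n-1\}$. The dYoke graph $Z_{n,m}$ has as vertices all tuples $u=(u_0,\dots,u_{m+1})$ with $u_0,u_{m+1}\in\mathbb{Z}_n$, $u_1,\dots,u_m\in\{ -1,0,1\}$ and $\sum_{i=0}^{m+1}u_i\equiv0\pmod n$; adjacency: there is $0\le i\le m$ with $u_j=v_j$ for $j\notin\{i,i+1\}$ and either ($u_i=v_i+1$, $u_{i+1}=v_{i+1}-1$) or ($u_i=v_i-1$, $u_{i+1}=v_{i+1}+1$), arithmetic in coordinates $0,m+1$ in $\mathbb{Z}_n$. -}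

module Defs where

open import Data.Nat using (ℕ; zero; suc; _≤_)
open import Data.Fin using (Fin; zero; suc; toℕ; inject₁)
open import Data.Integer using (ℤ; +_; -_; _+_; _-_) renaming (_≤_ to _≤ℤ_; _<_ to _<ℤ_)
open import Data.Integer.Divisibility using (_∣_)
open import Data.Vec using (Vec; []; _∷_; lookup; replicate)
open import Data.Product using (Σ; ∃; _×_)
open import Data.Sum using (_⊎_)
open import Relation.Nullary using (¬_)
open import Relation.Binary.PropositionalEquality using (_≡_)

sumV : ∀ {k} → Vec ℤ k → ℤ
sumV []       = + 0
sumV (x ∷ xs) = x + sumV xs

-- Tuples (u_0, …, u_{m+1}) are vectors of length 2 + m.
Tuple : ℕ → Set
Tuple m = Vec ℤ (suc (suc m))

-- The two "Z_n" coordinates 0 and m+1.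
IsEnd : ∀ {m} → Fin (suc (suc m)) → Set
IsEnd {m} j = toℕ j ≡ 0 ⊎ toℕ j ≡ suc m

infix 4 _≡[mod_]_
_≡[mod_]_ : ℤ → ℕ → ℤ → Set
a ≡[mod n ] b = (+ n) ∣ (a - b)

Valid : (n m : ℕ) → Tuple m → Set
Valid n m u =
  (∀ j → IsEnd j → (+ 0 ≤ℤ lookup u j) × (lookup u j <ℤ + n)) ×
  (∀ j → ¬ IsEnd j → (- (+ 1) ≤ℤ lookup u j) × (lookup u j ≤ℤ + 1)) ×
  (sumV u ≡[mod n ] + 0)

CoordShift : (n : ℕ) {m : ℕ} → Fin (suc (suc m)) → ℤ → ℤ → ℤ → Set
CoordShift n j a b d = (IsEnd j × (a ≡[mod n ] (b + d))) ⊎ (¬ IsEnd j × a ≡ b + d)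

Adj : (n m : ℕ) → Tuple m → Tuple m → Set
Adj n m u v = ∃ λ (i : Fin (suc m)) →
  (∀ j → ¬ j ≡ inject₁ i → ¬ j ≡ suc i → lookup u j ≡ lookup v j) ×
  ((CoordShift n (inject₁ i) (lookup u (inject₁ i)) (lookup v (inject₁ i)) (+ 1) ×
    CoordShift n (suc i) (lookup u (suc i)) (lookup v (suc i)) (- (+ 1)))
   ⊎
   (CoordShift n (inject₁ i) (lookup u (inject₁ i)) (lookup v (inject₁ i)) (- (+ 1)) ×
    CoordShift n (suc i) (lookup u (suc i)) (lookup v (suc i)) (+ 1)))

-- Walks of a given length in Z_{n,m}, through vertices (every vertex after
-- the start is required to be valid; the start is valid by hypothesis of use).
data Walk (n m : ℕ) : Tuple m → Tuple m → ℕ → Set where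
  nil  : ∀ {x} → Walk n m x x 0
  cons : ∀ {x y z k} → Valid n m y → Adj n m x y → Walk n m y z k → Walk n m x z (suc k)

Dist : (n m : ℕ) → Tuple m → Tuple m → ℕ → Set
Dist n m x y d = Walk n m x y d × (∀ k → Walk n m x y k → d ≤ k)

Ecc : (n m : ℕ) → Tuple m → ℕ → Set
Ecc n m x e =
  (∀ y → Valid n m y → ∃ λ d → Dist n m x y d × d ≤ e) ×
  (∃ λ y → Valid n m y × Dist n m x y e)

zeroT : (m : ℕ) → Tuple m
zeroT m = replicate _ (+ 0)

module Submission where

-- Vertices are described by height functions: an integer sequence t 0, …, t m whose steps
-- t (j+1) - t j lie in {-1, 0, 1} ("Lipschitz") encodes the vertex
--   u₀ = t 0 mod n,   u_{j+1} = t (j+1) - t j   (j < m),   u_{m+1} = - t m mod n.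
-- The height functions of a vertex y are exactly its lifts c + y₁ + … + y_j with c ≡ y₀ (mod n),
-- and the edges of Z_{n,m} are the unit changes of one value of t.  With the weight
-- Φ(t) = |t 0| + … + |t m| the distance from 0 to y is therefore the least weight of a height
-- function of y: a walk of length k raises Φ by at most k, and conversely moving a value of
-- maximal absolute value one step towards 0 keeps t Lipschitz and lowers Φ by one.
-- Upper bound: every Lipschitz t has a shift s = t - q n that either vanishes somewhere (then
-- Φ(s) ≤ m (m+1)/2 ≤ n (m+1)/2) or stays in [0, n] (then Φ(s) + Φ(s - n) = n (m+1)).
-- Lower bound: every shift of f j = ⌊n/2⌋ + (n mod 2)·(j mod 2) by a multiple of n has
-- Φ ≥ ⌊n (m+1)/2⌋.

open import Defs
import Data.Nat as ℕ
import Data.Nat.Properties as ℕP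
import Data.Nat.DivMod as ℕD
import Data.Nat.Divisibility as ℕDiv
import Data.Nat.Tactic.RingSolver as ℕSolver
open import Data.Nat.Base using (ℕ; zero; suc; z≤n; s≤s)
open import Data.Nat.Induction using (<-rec)
open import Data.Integer.Base
  using (ℤ; +_; -[1+_]; +[1+_]; -_; _+_; _-_; _*_; _≤_; _<_; ∣_∣; +≤+; -≤+; -≤-; +<+)
import Data.Integer.Base as ℤ
import Data.Integer.Properties as ℤP
import Data.Integer.DivMod as ℤD
open import Data.Integer.Divisibility.Signed
  using (_∣_; divides; ∣⇒∣ᵤ; ∣ᵤ⇒∣; ∣m∣n⇒∣m+n; ∣m∣n⇒∣m-n; ∣m⇒∣-m; ∣n⇒∣m*n; ∣-refl; _∣?_)
open import Data.Integer.Tactic.RingSolver using (solve-∀)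
open import Data.Fin using (Fin; zero; suc; toℕ; inject₁; fromℕ<)
open import Data.Vec using (Vec; []; _∷_; lookup; tabulate; replicate)
import Data.Vec.Properties as VecP
import Data.Fin.Properties as FinP
open import Data.Product using (∃; _×_; _,_; proj₁; proj₂)
open import Data.Sum using (_⊎_; inj₁; inj₂)
open import Data.Empty using (⊥-elim)
open import Relation.Nullary using (¬_; Dec; yes; no)
open import Relation.Nullary.Decidable using (_×-dec_)
open import Relation.Unary using (Decidable)
open import Relation.Binary.PropositionalEquality
open import Function using (_∘_)
open import Algebra.Properties.CommutativeSemigroup ℕP.+-commutativeSemigroup
  using () renaming (xy∙z≈xz∙y to +-swap)

sumℕ : (ℕ → ℕ) → ℕ → ℕ
sumℕ f zero    = 0
sumℕ f (suc k) = sumℕ f k ℕ.+ f k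

sumℕ-cong : ∀ k {f g : ℕ → ℕ} → (∀ j → j ℕ.< k → f j ≡ g j) → sumℕ f k ≡ sumℕ g k
sumℕ-cong zero    eq = refl
sumℕ-cong (suc k) eq = cong₂ ℕ._+_ (sumℕ-cong k (λ j j<k → eq j (ℕP.m≤n⇒m≤1+n j<k))) (eq k ℕP.≤-refl)

sumℕ-mono : ∀ k {f g : ℕ → ℕ} → (∀ j → j ℕ.< k → f j ℕ.≤ g j) → sumℕ f k ℕ.≤ sumℕ g k
sumℕ-mono zero    le = z≤n
sumℕ-mono (suc k) le = ℕP.+-mono-≤ (sumℕ-mono k (λ j j<k → le j (ℕP.m≤n⇒m≤1+n j<k))) (le k ℕP.≤-refl)

sumℕ-+ : ∀ k (f g : ℕ → ℕ) → sumℕ (λ j → f j ℕ.+ g j) k ≡ sumℕ f k ℕ.+ sumℕ g k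
sumℕ-+ zero    f g = refl
sumℕ-+ (suc k) f g = trans (cong (ℕ._+ (f k ℕ.+ g k)) (sumℕ-+ k f g)) (interchange (sumℕ f k) (sumℕ g k) (f k) (g k))
  where
  interchange : ∀ a b c d → a ℕ.+ b ℕ.+ (c ℕ.+ d) ≡ a ℕ.+ c ℕ.+ (b ℕ.+ d)
  interchange = ℕSolver.solve-∀

sumℕ-const : ∀ k c → sumℕ (λ _ → c) k ≡ k ℕ.* c
sumℕ-const zero    c = refl
sumℕ-const (suc k) c = trans (cong (ℕ._+ c) (sumℕ-const k c)) (ℕP.+-comm (k ℕ.* c) c)

sumℕ-scale : ∀ k c (f : ℕ → ℕ) → sumℕ (λ j → c ℕ.* f j) k ≡ c ℕ.* sumℕ f k
sumℕ-scale zero    c f = sym (ℕP.*-zeroʳ c)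
sumℕ-scale (suc k) c f =
  trans (cong (ℕ._+ c ℕ.* f k) (sumℕ-scale k c f)) (sym (ℕP.*-distribˡ-+ c (sumℕ f k) (f k)))

sumℕ-zero : ∀ k (f : ℕ → ℕ) → (∀ j → j ℕ.< k → f j ≡ 0) → sumℕ f k ≡ 0
sumℕ-zero k f eq = trans (sumℕ-cong k eq) (trans (sumℕ-const k 0) (ℕP.*-zeroʳ k))

sumℕ-zero⁻¹ : ∀ k (f : ℕ → ℕ) → sumℕ f k ≡ 0 → ∀ j → j ℕ.< k → f j ≡ 0
sumℕ-zero⁻¹ (suc k) f eq j j<1+k with j ℕ.≟ k
... | yes refl = ℕP.m+n≡0⇒n≡0 (sumℕ f j) eq
... | no  j≢k  = sumℕ-zero⁻¹ k f (ℕP.m+n≡0⇒m≡0 (sumℕ f k) eq) j (ℕP.≤∧≢⇒< (ℕP.≤-pred j<1+k) j≢k)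

sumℕ-head : ∀ k (f : ℕ → ℕ) → f 0 ℕ.≤ sumℕ f (suc k)
sumℕ-head zero    f = ℕP.≤-refl
sumℕ-head (suc k) f = ℕP.≤-trans (sumℕ-head k f) (ℕP.m≤m+n _ _)

sumℕ-update : ∀ k (f g : ℕ → ℕ) i → i ℕ.< k → (∀ j → j ≢ i → f j ≡ g j) →
              sumℕ f k ℕ.+ g i ≡ sumℕ g k ℕ.+ f i
sumℕ-update (suc k) f g i i<1+k agree with i ℕ.≟ k
... | yes refl = begin
  sumℕ f i ℕ.+ f i ℕ.+ g i ≡⟨ cong (λ z → z ℕ.+ f i ℕ.+ g i) (sumℕ-cong i (λ j j<i → agree j (ℕP.<⇒≢ j<i))) ⟩
  sumℕ g i ℕ.+ f i ℕ.+ g i ≡⟨ +-swap (sumℕ g i) (f i) (g i) ⟩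
  sumℕ g i ℕ.+ g i ℕ.+ f i ∎
  where open ≡-Reasoning
... | no i≢k = begin
  sumℕ f k ℕ.+ f k ℕ.+ g i   ≡⟨ +-swap (sumℕ f k) (f k) (g i) ⟩
  sumℕ f k ℕ.+ g i ℕ.+ f k   ≡⟨ cong₂ ℕ._+_ (sumℕ-update k f g i (ℕP.≤∧≢⇒< (ℕP.≤-pred i<1+k) i≢k) agree)
                                            (agree k (λ k≡i → i≢k (sym k≡i))) ⟩
  sumℕ g k ℕ.+ f i ℕ.+ g k   ≡⟨ +-swap (sumℕ g k) (f i) (g k) ⟩
  sumℕ g k ℕ.+ g k ℕ.+ f i   ∎
  where open ≡-Reasoning

-- Finite sums of integers, accumulated from the left so that they match sumV.
sumℤ : (ℕ → ℤ) → ℕ → ℤ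
sumℤ g zero    = + 0
sumℤ g (suc k) = g 0 + sumℤ (λ j → g (suc j)) k

sumℤ-snoc : ∀ k (g : ℕ → ℤ) → sumℤ g (suc k) ≡ sumℤ g k + g k
sumℤ-snoc zero    g = trans (ℤP.+-identityʳ (g 0)) (sym (ℤP.+-identityˡ (g 0)))
sumℤ-snoc (suc k) g = trans (cong (_+_ (g 0)) (sumℤ-snoc k (λ j → g (suc j)))) (sym (ℤP.+-assoc (g 0) _ _))

sumℤ-cong : ∀ k {f g : ℕ → ℤ} → (∀ j → j ℕ.< k → f j ≡ g j) → sumℤ f k ≡ sumℤ g k
sumℤ-cong zero    eq = refl
sumℤ-cong (suc k) eq = cong₂ _+_ (eq 0 (s≤s z≤n)) (sumℤ-cong k (λ j j<k → eq (suc j) (s≤s j<k)))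

sumℤ-telescope : ∀ k (h : ℕ → ℤ) → sumℤ (λ j → h (suc j) - h j) k ≡ h k - h 0
sumℤ-telescope zero    h = sym (ℤP.+-inverseʳ (h 0))
sumℤ-telescope (suc k) h =
  trans (cong (_+_ (h 1 - h 0)) (sumℤ-telescope k (λ j → h (suc j)))) (chain (h 0) (h 1) (h (suc k)))
  where
  chain : ∀ a b c → (b - a) + (c - b) ≡ c - a
  chain = solve-∀

-- The entries of a vector as a sequence indexed by ℕ (zero beyond the end).
entry : ∀ {k} → Vec ℤ k → ℕ → ℤ
entry []       _       = + 0
entry (x ∷ xs) zero    = x
entry (x ∷ xs) (suc j) = entry xs j

entry-lookup : ∀ {k} (v : Vec ℤ k) (j : Fin k) → entry v (toℕ j) ≡ lookup v j
entry-lookup (x ∷ xs) zero    = refl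
entry-lookup (x ∷ xs) (suc j) = entry-lookup xs j

sumV-entry : ∀ {k} (v : Vec ℤ k) → sumV v ≡ sumℤ (entry v) k
sumV-entry []       = refl
sumV-entry (x ∷ xs) = cong (_+_ x) (sumV-entry xs)

sumV-tabulate : ∀ k (g : ℕ → ℤ) → sumV (tabulate {n = k} (λ j → g (toℕ j))) ≡ sumℤ g k
sumV-tabulate zero    g = refl
sumV-tabulate (suc k) g = cong (_+_ (g 0)) (sumV-tabulate k (λ j → g (suc j)))

argmax : ∀ m (f : ℕ → ℕ) → ∃ λ i → i ℕ.≤ m × (∀ j → j ℕ.≤ m → f j ℕ.≤ f i)
argmax zero    f = 0 , z≤n , λ { zero _ → ℕP.≤-refl }
argmax (suc m) f with argmax m f
... | i , i≤m , max with ℕP.≤-total (f i) (f (suc m))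
...   | inj₁ fi≤ = suc m , ℕP.≤-refl , below
  where
  below : ∀ j → j ℕ.≤ suc m → f j ℕ.≤ f (suc m)
  below j j≤ with j ℕ.≟ suc m
  ... | yes refl = ℕP.≤-refl
  ... | no  j≢   = ℕP.≤-trans (max j (ℕP.≤-pred (ℕP.≤∧≢⇒< j≤ j≢))) fi≤
...   | inj₂ fs≤ = i , ℕP.m≤n⇒m≤1+n i≤m , below
  where
  below : ∀ j → j ℕ.≤ suc m → f j ℕ.≤ f i
  below j j≤ with j ℕ.≟ suc m
  ... | yes refl = fs≤
  ... | no  j≢   = max j (ℕP.≤-pred (ℕP.≤∧≢⇒< j≤ j≢))

leastWitness : ∀ {P : ℕ → Set} → Decidable P → ∀ e → P e → ∃ λ d → P d × (∀ d' → P d' → d ℕ.≤ d')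
leastWitness {P} P? = <-rec Least search
  where
  Least : ℕ → Set
  Least e = P e → ∃ λ d → P d × (∀ d' → P d' → d ℕ.≤ d')
  search : ∀ e → (∀ {d} → d ℕ.< e → Least d) → Least e
  search e smaller pe with ℕP.anyUpTo? P? e
  ... | yes (d , d<e , pd) = smaller d<e pd
  ... | no  none           = e , pe , λ d' pd' → ℕP.≮⇒≥ (λ d'<e → none (d' , d'<e , pd'))

Lipschitz : ℕ → (ℕ → ℤ) → Set
Lipschitz m t = ∀ j → j ℕ.< m → ∣ t (suc j) - t j ∣ ℕ.≤ 1

abs≤1⇒bounds : ∀ x → ∣ x ∣ ℕ.≤ 1 → (- + 1 ≤ x) × (x ≤ + 1)
abs≤1⇒bounds (+ 0)          _         = -≤+ , +≤+ z≤n
abs≤1⇒bounds (+ 1)          _         = -≤+ , +≤+ (s≤s z≤n)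
abs≤1⇒bounds +[1+ suc k ]   (s≤s ())
abs≤1⇒bounds -[1+ 0 ]       _         = -≤- z≤n , -≤+
abs≤1⇒bounds -[1+ suc k ]   (s≤s ())

bounds⇒abs≤1 : ∀ x → - + 1 ≤ x → x ≤ + 1 → ∣ x ∣ ℕ.≤ 1
bounds⇒abs≤1 (+ 0)        _        _               = z≤n
bounds⇒abs≤1 (+ 1)        _        _               = ℕP.≤-refl
bounds⇒abs≤1 +[1+ suc k ] _        (+≤+ (s≤s ()))
bounds⇒abs≤1 -[1+ 0 ]     _        _               = ℕP.≤-refl
bounds⇒abs≤1 -[1+ suc k ] (-≤- ()) _

-- The weight Φ(t) = |t 0| + … + |t m|; it will measure distances from the zero vertex.
weight : ℕ → (ℕ → ℤ) → ℕ
weight m t = sumℕ (λ j → ∣ t j ∣) (suc m)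

weight-cong : ∀ m {t s : ℕ → ℤ} → (∀ j → j ℕ.≤ m → t j ≡ s j) → weight m t ≡ weight m s
weight-cong m eq = sumℕ-cong (suc m) (λ j j<1+m → cong ∣_∣ (eq j (ℕP.≤-pred j<1+m)))

∣head∣≤weight : ∀ m t → ∣ t 0 ∣ ℕ.≤ weight m t
∣head∣≤weight m t = sumℕ-head m (λ j → ∣ t j ∣)

bump : (ℕ → ℤ) → ℕ → ℤ → ℕ → ℤ
bump t i d j with j ℕ.≟ i
... | yes _ = t j + d
... | no  _ = t j

bump-at : ∀ t i d → bump t i d i ≡ t i + d
bump-at t i d with i ℕ.≟ i
... | yes _   = refl
... | no  i≢i = ⊥-elim (i≢i refl)

bump-off : ∀ t i d j → j ≢ i → bump t i d j ≡ t j
bump-off t i d j j≢i with j ℕ.≟ i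
... | yes j≡i = ⊥-elim (j≢i j≡i)
... | no  _   = refl

weight-bump≤ : ∀ m t i d → i ℕ.≤ m → ∣ d ∣ ≡ 1 → weight m (bump t i d) ℕ.≤ suc (weight m t)
weight-bump≤ m t i d i≤m ∣d∣≡1 = ℕP.+-cancelʳ-≤ ∣ t i ∣ (weight m (bump t i d)) (suc (weight m t)) (begin
  weight m (bump t i d) ℕ.+ ∣ t i ∣
    ≡⟨ sumℕ-update (suc m) (λ j → ∣ bump t i d j ∣) (λ j → ∣ t j ∣) i (s≤s i≤m)
                   (λ j j≢i → cong ∣_∣ (bump-off t i d j j≢i)) ⟩
  weight m t ℕ.+ ∣ bump t i d i ∣
    ≤⟨ ℕP.+-monoʳ-≤ (weight m t) ∣t+d∣≤ ⟩
  weight m t ℕ.+ (∣ t i ∣ ℕ.+ 1)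
    ≡⟨ cong (weight m t ℕ.+_) (ℕP.+-comm ∣ t i ∣ 1) ⟩
  weight m t ℕ.+ suc ∣ t i ∣
    ≡⟨ ℕP.+-suc (weight m t) ∣ t i ∣ ⟩
  suc (weight m t) ℕ.+ ∣ t i ∣ ∎)
  where
  open ℕP.≤-Reasoning
  ∣t+d∣≤ : ∣ bump t i d i ∣ ℕ.≤ ∣ t i ∣ ℕ.+ 1
  ∣t+d∣≤ = subst₂ (λ x k → ∣ x ∣ ℕ.≤ ∣ t i ∣ ℕ.+ k) (sym (bump-at t i d)) ∣d∣≡1 (ℤP.∣i+j∣≤∣i∣+∣j∣ (t i) d)

IsUnit : ℤ → Set
IsUnit d = d ≡ + 1 ⊎ d ≡ - + 1

TowardZero : ℤ → ℤ → Set
TowardZero a d = (∃ λ p → a ≡ +[1+ p ] × d ≡ - + 1) ⊎ (∃ λ p → a ≡ -[1+ p ] × d ≡ + 1)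

towardZero-abs : ∀ a d → TowardZero a d → ∣ a ∣ ≡ suc ∣ a + d ∣
towardZero-abs a d (inj₁ (p , refl , refl)) = refl
towardZero-abs a d (inj₂ (p , refl , refl)) = cong suc (sym (ℤP.∣⊖∣-≤ (s≤s z≤n)))

weight-bump-toward : ∀ m t i d → i ℕ.≤ m → TowardZero (t i) d →
                     weight m t ≡ suc (weight m (bump t i d))
weight-bump-toward m t i d i≤m toward =
  ℕP.+-cancelʳ-≡ ∣ bump t i d i ∣ (weight m t) (suc (weight m (bump t i d))) (begin
  weight m t ℕ.+ ∣ bump t i d i ∣
    ≡⟨ sumℕ-update (suc m) (λ j → ∣ t j ∣) (λ j → ∣ bump t i d j ∣) i (s≤s i≤m)
                   (λ j j≢i → cong ∣_∣ (sym (bump-off t i d j j≢i))) ⟩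
  weight m (bump t i d) ℕ.+ ∣ t i ∣
    ≡⟨ cong (weight m (bump t i d) ℕ.+_)
            (trans (towardZero-abs (t i) d toward) (cong (λ x → suc ∣ x ∣) (sym (bump-at t i d)))) ⟩
  weight m (bump t i d) ℕ.+ suc ∣ bump t i d i ∣
    ≡⟨ ℕP.+-suc _ _ ⟩
  suc (weight m (bump t i d)) ℕ.+ ∣ bump t i d i ∣ ∎)
  where open ≡-Reasoning

b≡a+[b-a] : ∀ a b → b ≡ a + (b - a)
b≡a+[b-a] = solve-∀
b≡[b-a]+a : ∀ a b → b ≡ (b - a) + a
b≡[b-a]+a = solve-∀
a-[a+d]≡-d : ∀ a d → a - (a + d) ≡ - d
a-[a+d]≡-d = solve-∀

neighbours : ∀ a b → ∣ b - a ∣ ℕ.≤ 1 → b ≡ a + - + 1 ⊎ b ≡ a ⊎ b ≡ a + + 1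
neighbours a b ∣b-a∣≤1 with b - a in b-a≡ | abs≤1⇒bounds (b - a) ∣b-a∣≤1
... | + 0          | _ = inj₂ (inj₁ (trans (b≡a+[b-a] a b) (trans (cong (_+_ a) b-a≡) (ℤP.+-identityʳ a))))
... | + 1          | _ = inj₂ (inj₂ (trans (b≡a+[b-a] a b) (cong (_+_ a) b-a≡)))
... | -[1+ 0 ]     | _ = inj₁ (trans (b≡a+[b-a] a b) (cong (_+_ a) b-a≡))
... | +[1+ suc k ] | _ , +≤+ (s≤s ())
... | -[1+ suc k ] | -≤- () , _

towardZero-neighbour : ∀ a b d → TowardZero a d → ∣ b - a ∣ ℕ.≤ 1 → ∣ b ∣ ℕ.≤ ∣ a ∣ →
                       ∣ b - (a + d) ∣ ℕ.≤ 1
towardZero-neighbour a b d toward ∣b-a∣≤1 ∣b∣≤∣a∣ with neighbours a b ∣b-a∣≤1 | toward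
... | inj₁ refl        | inj₁ (p , refl , refl) = subst (ℕ._≤ 1) (sym (cong ∣_∣ (ℤP.+-inverseʳ (a + d)))) z≤n
... | inj₂ (inj₁ refl) | inj₁ (p , refl , refl) = ℕP.≤-reflexive (cong ∣_∣ (a-[a+d]≡-d a d))
... | inj₂ (inj₂ refl) | inj₁ (p , refl , refl) =
  ⊥-elim (ℕP.<-irrefl refl (subst (ℕ._≤ suc p) (cong suc (ℕP.+-comm p 1)) ∣b∣≤∣a∣))
... | inj₁ refl        | inj₂ (p , refl , refl) =
  ⊥-elim (ℕP.<-irrefl refl (subst (ℕ._≤ suc p) (cong (λ k → suc (suc k)) (ℕP.+-identityʳ p)) ∣b∣≤∣a∣))
... | inj₂ (inj₁ refl) | inj₂ (p , refl , refl) = ℕP.≤-reflexive (cong ∣_∣ (a-[a+d]≡-d a d))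
... | inj₂ (inj₂ refl) | inj₂ (p , refl , refl) = subst (ℕ._≤ 1) (sym (cong ∣_∣ (ℤP.+-inverseʳ (a + d)))) z≤n

bump-lipschitz : ∀ m t i d → TowardZero (t i) d → (∀ j → j ℕ.≤ m → ∣ t j ∣ ℕ.≤ ∣ t i ∣) →
                 Lipschitz m t → Lipschitz m (bump t i d)
bump-lipschitz m t i d toward maximal lip j j<m = by-position (suc j ℕ.≟ i) (j ℕ.≟ i)
  where
  step : ∀ {a b a' b'} → a' ≡ a → b' ≡ b → ∣ b - a ∣ ℕ.≤ 1 → ∣ b' - a' ∣ ℕ.≤ 1
  step refl refl le = le
  flip : ∀ a b → ∣ a - b ∣ ℕ.≤ 1 → ∣ b - a ∣ ℕ.≤ 1
  flip a b = subst (ℕ._≤ 1) (ℤP.∣i-j∣≡∣j-i∣ a b)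
  by-position : Dec (suc j ≡ i) → Dec (j ≡ i) → ∣ bump t i d (suc j) - bump t i d j ∣ ℕ.≤ 1
  by-position (yes refl) _ =
    step (bump-off t i d j (ℕP.<⇒≢ (ℕP.n<1+n j))) (bump-at t i d)
      (flip (t j) (t i + d) (towardZero-neighbour (t i) (t j) d toward
        (flip (t i) (t j) (lip j j<m)) (maximal j (ℕP.<⇒≤ j<m))))
  by-position (no _) (yes refl) =
    step (bump-at t i d) (bump-off t i d (suc j) (ℕP.<⇒≢ (ℕP.n<1+n j) ∘ sym))
      (towardZero-neighbour (t i) (t (suc j)) d toward (lip j j<m) (maximal (suc j) j<m))
  by-position (no 1+j≢i) (no j≢i) = step (bump-off t i d j j≢i) (bump-off t i d (suc j) 1+j≢i) (lip j j<m)

descend : ∀ m t k → Lipschitz m t → weight m t ≡ suc k →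
          ∃ λ i → ∃ λ d → i ℕ.≤ m × IsUnit d × Lipschitz m (bump t i d) × weight m (bump t i d) ≡ k
descend m t k lip weight≡ with argmax m (λ j → ∣ t j ∣)
... | i , i≤m , maximal = by-sign (t i) refl
  where
  Result = ∃ λ i → ∃ λ d → i ℕ.≤ m × IsUnit d × Lipschitz m (bump t i d) × weight m (bump t i d) ≡ k
  move : ∀ d → IsUnit d → TowardZero (t i) d → Result
  move d unit toward = i , d , i≤m , unit , bump-lipschitz m t i d toward maximal lip ,
                       ℕP.suc-injective (trans (sym (weight-bump-toward m t i d i≤m toward)) weight≡)
  by-sign : ∀ v → t i ≡ v → Result
  by-sign +[1+ p ] tᵢ≡ = move (- + 1) (inj₂ refl) (inj₁ (p , tᵢ≡ , refl))
  by-sign -[1+ p ] tᵢ≡ = move (+ 1) (inj₁ refl) (inj₂ (p , tᵢ≡ , refl))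
  by-sign (+ 0)    tᵢ≡ = ⊥-elim (ℕP.0≢1+n (trans (sym (sumℕ-zero (suc m) (λ j → ∣ t j ∣) all-zero)) weight≡))
    where
    all-zero : ∀ j → j ℕ.< suc m → ∣ t j ∣ ≡ 0
    all-zero j j<1+m = ℕP.n≤0⇒n≡0 (subst (λ x → ∣ t j ∣ ℕ.≤ ∣ x ∣) tᵢ≡ (maximal j (ℕP.≤-pred j<1+m)))

ivt-up : ∀ m s → Lipschitz m s → ∀ v j → j ℕ.≤ m → s 0 ≤ v → v ≤ s j → ∃ λ i → i ℕ.≤ j × s i ≡ v
ivt-up m s lip v zero    _     s₀≤v v≤sⱼ = 0 , z≤n , ℤP.≤-antisym s₀≤v v≤sⱼ
ivt-up m s lip v (suc j) 1+j≤m s₀≤v v≤sⱼ with v ℤP.≤? s j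
... | yes v≤ = let (i , i≤j , sᵢ≡v) = ivt-up m s lip v j (ℕP.<⇒≤ 1+j≤m) s₀≤v v≤ in
               i , ℕP.m≤n⇒m≤1+n i≤j , sᵢ≡v
... | no  v≰ = suc j , ℕP.≤-refl , ℤP.≤-antisym s₁₊ⱼ≤v v≤sⱼ
  where
  step≤1 : s (suc j) - s j ≤ + 1
  step≤1 = proj₂ (abs≤1⇒bounds _ (lip j 1+j≤m))
  s₁₊ⱼ≤v : s (suc j) ≤ v
  s₁₊ⱼ≤v = ℤP.≤-trans (subst (_≤ + 1 + s j) (sym (b≡[b-a]+a (s j) (s (suc j)))) (ℤP.+-monoˡ-≤ (s j) step≤1))
                      (ℤP.i<j⇒suc[i]≤j (ℤP.≰⇒> v≰))

negate-lipschitz : ∀ m s → Lipschitz m s → Lipschitz m (λ j → - s j)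
negate-lipschitz m s lip j j<m =
  subst (ℕ._≤ 1) (trans (sym (ℤP.∣-i∣≡∣i∣ (s (suc j) - s j))) (cong ∣_∣ (neg-distrib-diff (s (suc j)) (s j))))
        (lip j j<m)
  where
  neg-distrib-diff : ∀ a b → - (a - b) ≡ - a - - b
  neg-distrib-diff = solve-∀

shift-lipschitz : ∀ m s c → Lipschitz m s → Lipschitz m (λ j → s j - c)
shift-lipschitz m s c lip j j<m = subst (λ x → ∣ x ∣ ℕ.≤ 1) (shift-diff (s (suc j)) (s j) c) (lip j j<m)
  where
  shift-diff : ∀ a b c → a - b ≡ (a - c) - (b - c)
  shift-diff = solve-∀

ivt-down : ∀ m s → Lipschitz m s → ∀ v j → j ℕ.≤ m → v ≤ s 0 → s j ≤ v → ∃ λ i → i ℕ.≤ j × s i ≡ v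
ivt-down m s lip v j j≤m v≤s₀ sⱼ≤v
  with ivt-up m (λ j → - s j) (negate-lipschitz m s lip) (- v) j j≤m (ℤP.neg-mono-≤ v≤s₀) (ℤP.neg-mono-≤ sⱼ≤v)
... | i , i≤j , -sᵢ≡-v = i , i≤j , ℤP.neg-injective -sᵢ≡-v

lipschitz-drift : ∀ m s → Lipschitz m s → ∀ a k → a ℕ.+ k ℕ.≤ m → ∣ s (a ℕ.+ k) - s a ∣ ℕ.≤ k
lipschitz-drift m s lip a zero _ rewrite ℕP.+-identityʳ a = ℕP.≤-reflexive (cong ∣_∣ (ℤP.+-inverseʳ (s a)))
lipschitz-drift m s lip a (suc k) a+1+k≤m rewrite ℕP.+-suc a k = begin
  ∣ s (suc b) - s a ∣                           ≡⟨ cong ∣_∣ (split (s (suc b)) (s b) (s a)) ⟩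
  ∣ (s (suc b) - s b) + (s b - s a) ∣           ≤⟨ ℤP.∣i+j∣≤∣i∣+∣j∣ (s (suc b) - s b) (s b - s a) ⟩
  ∣ s (suc b) - s b ∣ ℕ.+ ∣ s b - s a ∣         ≤⟨ ℕP.+-mono-≤ (lip b a+1+k≤m)
                                                     (lipschitz-drift m s lip a k (ℕP.<⇒≤ a+1+k≤m)) ⟩
  1 ℕ.+ k ∎
  where
  open ℕP.≤-Reasoning
  b = a ℕ.+ k
  split : ∀ x y z → x - z ≡ (x - y) + (y - z)
  split = solve-∀

lipschitz-distance : ∀ m s → Lipschitz m s → ∀ j i → j ℕ.≤ m → i ℕ.≤ m → ∣ s j - s i ∣ ℕ.≤ ℕ.∣ j - i ∣
lipschitz-distance m s lip j i j≤m i≤m with ℕP.≤-total i j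
... | inj₁ i≤j = subst₂ (λ x k → ∣ s x - s i ∣ ℕ.≤ k) (ℕP.m+[n∸m]≡n i≤j) (sym (ℕP.m≤n⇒∣n-m∣≡n∸m i≤j))
                   (lipschitz-drift m s lip i (j ℕ.∸ i) (subst (ℕ._≤ m) (sym (ℕP.m+[n∸m]≡n i≤j)) j≤m))
... | inj₂ j≤i = subst₂ ℕ._≤_ (ℤP.∣i-j∣≡∣j-i∣ (s i) (s j)) (sym (ℕP.m≤n⇒∣m-n∣≡n∸m j≤i))
                   (subst (λ x → ∣ s x - s j ∣ ℕ.≤ i ℕ.∸ j) (ℕP.m+[n∸m]≡n j≤i)
                     (lipschitz-drift m s lip j (i ℕ.∸ j) (subst (ℕ._≤ m) (sym (ℕP.m+[n∸m]≡n j≤i)) i≤m)))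

distanceSum : ℕ → ℕ → ℕ
distanceSum m i = sumℕ (λ j → ℕ.∣ j - i ∣) (suc m)

distanceSum-end : ∀ k → distanceSum k k ℕ.* 2 ≡ k ℕ.* suc k
distanceSum-end zero    = refl
distanceSum-end (suc k) = begin
  (sumℕ (λ j → ℕ.∣ j - suc k ∣) (suc k) ℕ.+ ℕ.∣ k - k ∣) ℕ.* 2
    ≡⟨ cong₂ (λ a b → (a ℕ.+ b) ℕ.* 2) (trans (sumℕ-cong (suc k) one-further) (sumℕ-+ (suc k) _ (λ _ → 1)))
             (ℕP.∣n-n∣≡0 k) ⟩
  (distanceSum k k ℕ.+ sumℕ (λ _ → 1) (suc k) ℕ.+ 0) ℕ.* 2
    ≡⟨ cong (λ x → (distanceSum k k ℕ.+ x ℕ.+ 0) ℕ.* 2) (trans (sumℕ-const (suc k) 1) (ℕP.*-identityʳ (suc k))) ⟩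
  (distanceSum k k ℕ.+ suc k ℕ.+ 0) ℕ.* 2
    ≡⟨ distrib (distanceSum k k) k ⟩
  distanceSum k k ℕ.* 2 ℕ.+ suc k ℕ.* 2
    ≡⟨ cong (ℕ._+ suc k ℕ.* 2) (distanceSum-end k) ⟩
  k ℕ.* suc k ℕ.+ suc k ℕ.* 2
    ≡⟨ triangle-step k ⟩
  suc k ℕ.* suc (suc k) ∎
  where
  open ≡-Reasoning
  distrib : ∀ d k → (d ℕ.+ suc k ℕ.+ 0) ℕ.* 2 ≡ d ℕ.* 2 ℕ.+ suc k ℕ.* 2
  distrib = ℕSolver.solve-∀
  triangle-step : ∀ k → k ℕ.* suc k ℕ.+ suc k ℕ.* 2 ≡ suc k ℕ.* suc (suc k)
  triangle-step = ℕSolver.solve-∀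
  one-further : ∀ j → j ℕ.< suc k → ℕ.∣ j - suc k ∣ ≡ ℕ.∣ j - k ∣ ℕ.+ 1
  one-further j j<1+k = begin
    ℕ.∣ j - suc k ∣   ≡⟨ ℕP.m≤n⇒∣m-n∣≡n∸m (ℕP.m≤n⇒m≤1+n j≤k) ⟩
    suc k ℕ.∸ j       ≡⟨ ℕP.+-∸-assoc 1 j≤k ⟩
    suc (k ℕ.∸ j)     ≡⟨ cong suc (sym (ℕP.m≤n⇒∣m-n∣≡n∸m j≤k)) ⟩
    suc ℕ.∣ j - k ∣   ≡⟨ ℕP.+-comm 1 _ ⟩
    ℕ.∣ j - k ∣ ℕ.+ 1 ∎
    where j≤k = ℕP.≤-pred j<1+k

distanceSum-bound : ∀ m i → i ℕ.≤ m → distanceSum m i ℕ.* 2 ℕ.≤ m ℕ.* suc m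
distanceSum-bound zero    zero    _   = z≤n
distanceSum-bound (suc m) i       i≤1+m with i ℕ.≟ suc m
... | yes refl = ℕP.≤-reflexive (distanceSum-end (suc m))
... | no  i≢   = begin
  (distanceSum m i ℕ.+ ℕ.∣ suc m - i ∣) ℕ.* 2
    ≡⟨ ℕP.*-distribʳ-+ 2 (distanceSum m i) _ ⟩
  distanceSum m i ℕ.* 2 ℕ.+ ℕ.∣ suc m - i ∣ ℕ.* 2
    ≤⟨ ℕP.+-mono-≤ (distanceSum-bound m i (ℕP.≤-pred (ℕP.≤∧≢⇒< i≤1+m i≢)))
                   (ℕP.*-monoˡ-≤ 2 (ℕP.≤-trans (ℕP.∣m-n∣≤m⊔n (suc m) i) (ℕP.⊔-lub ℕP.≤-refl i≤1+m))) ⟩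
  m ℕ.* suc m ℕ.+ suc m ℕ.* 2
    ≡⟨ triangle-step m ⟩
  suc m ℕ.* suc (suc m) ∎
  where
  open ℕP.≤-Reasoning
  triangle-step : ∀ k → k ℕ.* suc k ℕ.+ suc k ℕ.* 2 ≡ suc k ℕ.* suc (suc k)
  triangle-step = ℕSolver.solve-∀

weight-near-zero : ∀ m s → Lipschitz m s → ∀ i → i ℕ.≤ m → s i ≡ + 0 → weight m s ℕ.* 2 ℕ.≤ m ℕ.* suc m
weight-near-zero m s lip i i≤m sᵢ≡0 = ℕP.≤-trans (ℕP.*-monoˡ-≤ 2 weight≤distanceSum) (distanceSum-bound m i i≤m)
  where
  weight≤distanceSum : weight m s ℕ.≤ distanceSum m i
  weight≤distanceSum = sumℕ-mono (suc m) λ j j<1+m →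
    subst (λ x → ∣ s j - x ∣ ℕ.≤ ℕ.∣ j - i ∣ → ∣ s j ∣ ℕ.≤ ℕ.∣ j - i ∣) (sym sᵢ≡0)
      (subst (ℕ._≤ ℕ.∣ j - i ∣) (cong ∣_∣ (ℤP.+-identityʳ (s j))))
      (lipschitz-distance m s lip j i (ℕP.≤-pred j<1+m) i≤m)

Alternating : (ℕ → ℕ) → Set
Alternating w = ∀ j → w j ℕ.+ w (suc j) ≡ 1

alternating-count : ∀ w → Alternating w → ∀ k → k ℕ.≤ suc (sumℕ w k ℕ.* 2)
alternating-count w alt zero          = z≤n
alternating-count w alt (suc zero)    = s≤s z≤n
alternating-count w alt (suc (suc k)) = begin
  suc (suc k)                                   ≤⟨ s≤s (s≤s (alternating-count w alt k)) ⟩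
  suc (suc (suc (sumℕ w k ℕ.* 2)))              ≡⟨ cong suc (add-one (sumℕ w k)) ⟩
  suc ((sumℕ w k ℕ.+ 1) ℕ.* 2)                  ≡⟨ cong (λ x → suc (x ℕ.* 2)) two-more ⟩
  suc (sumℕ w (suc (suc k)) ℕ.* 2)              ∎
  where
  open ℕP.≤-Reasoning
  add-one : ∀ x → suc (suc (x ℕ.* 2)) ≡ (x ℕ.+ 1) ℕ.* 2
  add-one = ℕSolver.solve-∀
  two-more : sumℕ w k ℕ.+ 1 ≡ sumℕ w k ℕ.+ w k ℕ.+ w (suc k)
  two-more = trans (cong (sumℕ w k ℕ.+_) (sym (alt k))) (sym (ℕP.+-assoc (sumℕ w k) (w k) (w (suc k))))

parity : ℕ → ℕ
parity zero          = 0
parity (suc zero)    = 1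
parity (suc (suc j)) = parity j

parity-alternating : Alternating parity
parity-alternating zero          = refl
parity-alternating (suc zero)    = refl
parity-alternating (suc (suc j)) = parity-alternating j

parity≤1 : ∀ j → parity j ℕ.≤ 1
parity≤1 zero          = z≤n
parity≤1 (suc zero)    = ℕP.≤-refl
parity≤1 (suc (suc j)) = parity≤1 j

≤∣∣-pos : ∀ a x → + a ≤ x → a ℕ.≤ ∣ x ∣
≤∣∣-pos a (+ b) (+≤+ a≤b) = a≤b

≤∣∣-neg : ∀ a x → x ≤ - + a → a ℕ.≤ ∣ x ∣
≤∣∣-neg zero    x         _          = z≤n
≤∣∣-neg (suc a) -[1+ b ] (-≤- a≤b) = s≤s a≤b

twice : ∀ x → x ℕ.+ x ≡ x ℕ.* 2
twice x = trans (cong (x ℕ.+_) (sym (ℕP.+-identityʳ x))) (ℕP.*-comm 2 x)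

≤half : ∀ x M → x ℕ.* 2 ℕ.≤ M → x ℕ.≤ M ℕ./ 2
≤half x M x*2≤M = subst (ℕ._≤ M ℕ./ 2) (ℕD.m*n/n≡m x 2) (ℕD./-monoˡ-≤ 2 x*2≤M)

half≤ : ∀ M x → M ℕ.≤ suc (x ℕ.* 2) → M ℕ./ 2 ℕ.≤ x
half≤ M x M≤1+2x = ℕP.≤-pred (ℕD.m<n*o⇒m/o<n (s≤s M≤1+2x))

window : ∀ d c → ∣ c ∣ ℕ.≤ d → ∃ λ a → a ℕ.< suc (d ℕ.+ d) × + a - + d ≡ c
window d (+ a) a≤d = a ℕ.+ d , s≤s (ℕP.+-monoˡ-≤ d a≤d) ,
                     trans (cong (_- + d) (ℤP.pos-+ a d)) ([x+y]-y≡x (+ a) (+ d))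
  where
  [x+y]-y≡x : ∀ x y → (x + y) - y ≡ x
  [x+y]-y≡x = solve-∀
window d -[1+ a ] a<d = d ℕ.∸ suc a , s≤s (ℕP.≤-trans (ℕP.m∸n≤m d (suc a)) (ℕP.m≤m+n d d)) ,
  (begin
    + (d ℕ.∸ suc a) - + d           ≡⟨ ℤP.[+m]-[+n]≡m⊖n (d ℕ.∸ suc a) d ⟩
    (d ℕ.∸ suc a) ℤ.⊖ d             ≡⟨ ℤP.⊖-≤ (ℕP.m∸n≤m d (suc a)) ⟩
    - + (d ℕ.∸ (d ℕ.∸ suc a))       ≡⟨ cong (λ x → - + x) (ℕP.m∸[m∸n]≡n a<d) ⟩
    -[1+ a ]                        ∎)
  where open ≡-Reasoning

-- An ℕ-valued function on ℤ that dominates the absolute value attains its minimum on every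
-- nonempty decidable set of integers: only the finitely many c with |c| ≤ d can have f c ≤ d.
minimise : ∀ {P : ℤ → Set} → Decidable P → (f : ℤ → ℕ) → (∀ c → ∣ c ∣ ℕ.≤ f c) →
           ∀ c → P c → ∃ λ c → P c × (∀ c' → P c' → f c ℕ.≤ f c')
minimise {P} P? f ∣c∣≤fc c₀ pc₀ =
  let (d , (c , pc , fc≤d) , least) = leastWitness attained? (f c₀) (c₀ , pc₀ , ℕP.≤-refl)
  in  c , pc , λ c' pc' → ℕP.≤-trans fc≤d (least (f c') (c' , pc' , ℕP.≤-refl))
  where
  Attained : ℕ → Set
  Attained d = ∃ λ c → P c × f c ℕ.≤ d
  attained? : Decidable Attained
  attained? d with ℕP.anyUpTo? (λ a → P? (+ a - + d) ×-dec (f (+ a - + d) ℕ.≤? d)) (suc (d ℕ.+ d))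
  ... | yes (a , _ , pc , fc≤d) = yes (+ a - + d , pc , fc≤d)
  ... | no  none                = no λ (c , pc , fc≤d) →
    let (a , a< , c≡) = window d c (ℕP.≤-trans (∣c∣≤fc c) fc≤d) in
    none (a , a< , subst P (sym c≡) pc , subst (λ x → f x ℕ.≤ d) (sym c≡) fc≤d)

smaller-half : ∀ a b M → a ℕ.+ b ≡ M → a ℕ.* 2 ℕ.≤ M ⊎ b ℕ.* 2 ℕ.≤ M
smaller-half a b M refl with ℕP.≤-total a b
... | inj₁ a≤b = inj₁ (subst (ℕ._≤ a ℕ.+ b) (twice a) (ℕP.+-monoʳ-≤ a a≤b))
... | inj₂ b≤a = inj₂ (subst (ℕ._≤ a ℕ.+ b) (twice b) (ℕP.+-monoˡ-≤ b b≤a))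

module DYoke (n-1 : ℕ) where

  n : ℕ
  n = suc n-1

  N : ℤ
  N = + n

  -- The representative in {0,…,n-1} of an integer modulo n; kept opaque so that only
  -- its defining properties are used.
  opaque
    residue : ℤ → ℤ
    residue x = + (x ℤD.%ℕ n)

    residue-≥0 : ∀ x → + 0 ≤ residue x
    residue-≥0 x = +≤+ z≤n

    residue-<n : ∀ x → residue x < N
    residue-<n x = +<+ (ℤD.n%ℕd<d x n)

    residue-zero : residue (+ 0) ≡ + 0
    residue-zero = refl

    residue-split : ∀ x → x ≡ residue x + (x ℤD./ℕ n) * N
    residue-split x = ℤD.a≡a%ℕn+[a/ℕn]*n x n

    residue-congruent : ∀ x → N ∣ (residue x - x)
    residue-congruent x = divides (- (x ℤD./ℕ n)) (begin
      residue x - x                            ≡⟨ cong (_-_ (residue x)) (residue-split x) ⟩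
      residue x - (residue x + (x ℤD./ℕ n) * N) ≡⟨ cancel (residue x) (x ℤD./ℕ n) N ⟩
      - (x ℤD./ℕ n) * N                        ∎)
      where
      open ≡-Reasoning
      cancel : ∀ a q k → a - (a + q * k) ≡ - q * k
      cancel = solve-∀

  InRange : ℤ → Set
  InRange a = (+ 0 ≤ a) × (a < N)

  residues-unique : ∀ {a b} → + 0 ≤ a → a < N → + 0 ≤ b → b < N → N ∣ (a - b) → a ≡ b
  residues-unique {+ a} {+ b} _ (+<+ a<n) _ (+<+ b<n) n∣a-b with ∣ a ℤ.⊖ b ∣ in ∣a⊖b∣≡
  ... | zero  = ℤP.i-j≡0⇒i≡j (+ a) (+ b) (trans (ℤP.[+m]-[+n]≡m⊖n a b) (ℤP.∣i∣≡0⇒i≡0 ∣a⊖b∣≡))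
  ... | suc k = ⊥-elim (ℕP.<⇒≱ 1+k<n (ℕDiv.∣⇒≤ n∣1+k))
    where
    1+k<n : suc k ℕ.< n
    1+k<n = ℕP.≤-<-trans (subst (ℕ._≤ a ℕ.⊔ b) ∣a⊖b∣≡ (ℤP.∣m⊝n∣≤m⊔n a b)) (ℕP.⊔-lub a<n b<n)
    n∣1+k : n ℕDiv.∣ suc k
    n∣1+k = subst (λ x → n ℕDiv.∣ x) ∣a⊖b∣≡
              (subst (λ x → n ℕDiv.∣ ∣ x ∣) (ℤP.[+m]-[+n]≡m⊖n a b) (∣⇒∣ᵤ n∣a-b))

  coordOf : (m : ℕ) → (ℕ → ℤ) → ℕ → ℤ
  coordOf m t zero = residue (t 0)
  coordOf m t (suc k) with k ℕ.≟ m
  ... | yes _ = residue (- t m)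
  ... | no  _ = t (suc k) - t k

  vertexOf : (m : ℕ) → (ℕ → ℤ) → Tuple m
  vertexOf m t = tabulate (λ j → coordOf m t (toℕ j))

  lookup-vertexOf : ∀ m t j → lookup (vertexOf m t) j ≡ coordOf m t (toℕ j)
  lookup-vertexOf m t j = VecP.lookup∘tabulate (λ j → coordOf m t (toℕ j)) j

  coordOf-last : ∀ m t → coordOf m t (suc m) ≡ residue (- t m)
  coordOf-last m t with m ℕ.≟ m
  ... | yes _   = refl
  ... | no  m≢m = ⊥-elim (m≢m refl)

  coordOf-inner : ∀ m t k → k ≢ m → coordOf m t (suc k) ≡ t (suc k) - t k
  coordOf-inner m t k k≢m with k ℕ.≟ m
  ... | yes k≡m = ⊥-elim (k≢m k≡m)
  ... | no  _   = refl

  coordOf-cong : ∀ m {t s} → (∀ j → j ℕ.≤ m → t j ≡ s j) → ∀ c → c ℕ.≤ suc m → coordOf m t c ≡ coordOf m s c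
  coordOf-cong m {t} {s} t≗s zero    _ = cong residue (t≗s 0 z≤n)
  coordOf-cong m {t} {s} t≗s (suc k) (s≤s k≤m) = by-position (k ℕ.≟ m)
    where
    by-position : Dec (k ≡ m) → coordOf m t (suc k) ≡ coordOf m s (suc k)
    by-position (yes refl) = trans (coordOf-last k t) (trans (cong (λ x → residue (- x)) (t≗s k ℕP.≤-refl))
                                                             (sym (coordOf-last k s)))
    by-position (no k≢m)   = trans (coordOf-inner m t k k≢m)
      (trans (cong₂ _-_ (t≗s (suc k) (ℕP.≤∧≢⇒< k≤m k≢m)) (t≗s k k≤m)) (sym (coordOf-inner m s k k≢m)))

  vertexOf-cong : ∀ m {t s} → (∀ j → j ℕ.≤ m → t j ≡ s j) → vertexOf m t ≡ vertexOf m s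
  vertexOf-cong m t≗s = VecP.tabulate-cong (λ j → coordOf-cong m t≗s (toℕ j) (ℕP.≤-pred (FinP.toℕ<n j)))

  vertexOf-zero : ∀ m → vertexOf m (λ _ → + 0) ≡ zeroT m
  vertexOf-zero m = trans (VecP.tabulate-cong (λ j → trans (coord-zero (toℕ j)) (sym (VecP.lookup-replicate j (+ 0)))))
                          (VecP.tabulate∘lookup (replicate _ (+ 0)))
    where
    coord-zero : ∀ c → coordOf m (λ _ → + 0) c ≡ + 0
    coord-zero zero    = residue-zero
    coord-zero (suc k) with k ℕ.≟ m
    ... | yes _ = residue-zero
    ... | no  _ = refl

  sum-vertexOf : ∀ m t → sumV (vertexOf m t) ≡ residue (t 0) + ((t m - t 0) + residue (- t m))
  sum-vertexOf m t = begin
    sumV (vertexOf m t)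
      ≡⟨ sumV-tabulate (suc (suc m)) (coordOf m t) ⟩
    residue (t 0) + sumℤ inner (suc m)
      ≡⟨ cong (_+_ (residue (t 0))) (sumℤ-snoc m inner) ⟩
    residue (t 0) + (sumℤ inner m + coordOf m t (suc m))
      ≡⟨ cong (λ x → residue (t 0) + (x + coordOf m t (suc m)))
              (sumℤ-cong m (λ k k<m → coordOf-inner m t k (ℕP.<⇒≢ k<m))) ⟩
    residue (t 0) + (sumℤ (λ k → t (suc k) - t k) m + coordOf m t (suc m))
      ≡⟨ cong₂ (λ a b → residue (t 0) + (a + b)) (sumℤ-telescope m t) (coordOf-last m t) ⟩
    residue (t 0) + ((t m - t 0) + residue (- t m)) ∎
    where
    open ≡-Reasoning
    inner = λ k → coordOf m t (suc k)

  vertexOf-ends : ∀ m t j → IsEnd j → InRange (lookup (vertexOf m t) j)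
  vertexOf-ends m t j (inj₁ j≡0) rewrite lookup-vertexOf m t j | j≡0 = residue-≥0 (t 0) , residue-<n (t 0)
  vertexOf-ends m t j (inj₂ j≡last) rewrite lookup-vertexOf m t j | j≡last | coordOf-last m t =
    residue-≥0 (- t m) , residue-<n (- t m)

  vertexOf-valid : ∀ m t → Lipschitz m t → Valid n m (vertexOf m t)
  vertexOf-valid m t lip = vertexOf-ends m t , inner-range , ∣⇒∣ᵤ sum≡0
    where
    inner : ∀ c → c ℕ.< suc (suc m) → c ≢ 0 → c ≢ suc m → (- + 1 ≤ coordOf m t c) × (coordOf m t c ≤ + 1)
    inner zero    _                  c≢0 _      = ⊥-elim (c≢0 refl)
    inner (suc k) (s≤s (s≤s k≤m)) _ c≢last with k ℕ.≟ m
    ... | yes k≡m = ⊥-elim (c≢last (cong suc k≡m))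
    ... | no  k≢m = abs≤1⇒bounds _ (lip k (ℕP.≤∧≢⇒< k≤m k≢m))
    inner-range : ∀ j → ¬ IsEnd j → (- + 1 ≤ lookup (vertexOf m t) j) × (lookup (vertexOf m t) j ≤ + 1)
    inner-range j ¬end rewrite lookup-vertexOf m t j =
      inner (toℕ j) (FinP.toℕ<n j) (λ j≡0 → ¬end (inj₁ j≡0)) (λ j≡last → ¬end (inj₂ j≡last))
    regroup : ∀ a x b y → a + ((y - x) + b) - + 0 ≡ (a - x) + (b - - y)
    regroup = solve-∀
    sum≡0 : N ∣ (sumV (vertexOf m t) - + 0)
    sum≡0 = subst (N ∣_) (sym (trans (cong (_- + 0) (sum-vertexOf m t)) (regroup (residue (t 0)) (t 0) (residue (- t m)) (t m))))
                  (∣m∣n⇒∣m+n (residue-congruent (t 0)) (residue-congruent (- t m)))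

  residue-shift : ∀ x y d → x ≡ y + d → N ∣ (residue x - (residue y + d))
  residue-shift x y d refl = subst (N ∣_) (regroup (residue (y + d)) y (residue y) d)
                                   (∣m∣n⇒∣m-n (residue-congruent (y + d)) (residue-congruent y))
    where
    regroup : ∀ a y b d → (a - (y + d)) - (b - y) ≡ a - (b + d)
    regroup = solve-∀

  end-shift : ∀ {m} (j : Fin (suc (suc m))) x y d → IsEnd j → x ≡ y + d →
              CoordShift n j (residue x) (residue y) d
  end-shift j x y d end x≡y+d = inj₁ (end , ∣⇒∣ᵤ (residue-shift x y d x≡y+d))

  inner-shift : ∀ {m} (j : Fin (suc (suc m))) a b d → ¬ IsEnd j → a ≡ b + d → CoordShift n j a b d
  inner-shift j a b d ¬end a≡b+d = inj₂ (¬end , a≡b+d)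

  bump-shift-at : ∀ m t i d → i ℕ.≤ m → (j : Fin (suc (suc m))) → toℕ j ≡ i →
                  CoordShift n j (coordOf m (bump t i d) i) (coordOf m t i) d
  bump-shift-at m t zero    d _   j j≡0 = end-shift j (bump t 0 d 0) (t 0) d (inj₁ j≡0) (bump-at t 0 d)
  bump-shift-at m t (suc k) d k<m j j≡i = inner-shift j _ (coordOf m t (suc k)) d ¬end (begin
    coordOf m (bump t (suc k) d) (suc k)          ≡⟨ coordOf-inner m (bump t (suc k) d) k k≢m ⟩
    bump t (suc k) d (suc k) - bump t (suc k) d k ≡⟨ cong₂ _-_ (bump-at t (suc k) d)
                                                               (bump-off t (suc k) d k (ℕP.<⇒≢ (ℕP.n<1+n k))) ⟩
    (t (suc k) + d) - t k                         ≡⟨ regroup (t (suc k)) (t k) d ⟩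
    (t (suc k) - t k) + d                         ≡⟨ cong (_+ d) (sym (coordOf-inner m t k k≢m)) ⟩
    coordOf m t (suc k) + d                       ∎)
    where
    open ≡-Reasoning
    k≢m : k ≢ m
    k≢m k≡m = ℕP.<-irrefl k≡m k<m
    ¬end : ¬ IsEnd j
    ¬end (inj₁ j≡0)    with trans (sym j≡i) j≡0
    ... | ()
    ¬end (inj₂ j≡last) = k≢m (ℕP.suc-injective (trans (sym j≡i) j≡last))
    regroup : ∀ a b d → (a + d) - b ≡ (a - b) + d
    regroup = solve-∀

  bump-shift-after : ∀ m t i d → i ℕ.≤ m → (j : Fin (suc (suc m))) → toℕ j ≡ suc i →
                     CoordShift n j (coordOf m (bump t i d) (suc i)) (coordOf m t (suc i)) (- d)
  bump-shift-after m t i d i≤m j j≡1+i = by-position (i ℕ.≟ m)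
    where
    open ≡-Reasoning
    regroup : ∀ a b d → a - (b + d) ≡ (a - b) + - d
    regroup = solve-∀
    by-position : Dec (i ≡ m) →
                  CoordShift n j (coordOf m (bump t i d) (suc i)) (coordOf m t (suc i)) (- d)
    by-position (yes refl) =
      subst₂ (λ a b → CoordShift n j a b (- d)) (sym (coordOf-last i (bump t i d))) (sym (coordOf-last i t))
        (end-shift j (- bump t i d i) (- t i) (- d) (inj₂ j≡1+i)
          (trans (cong -_ (bump-at t i d)) (ℤP.neg-distrib-+ (t i) d)))
    by-position (no i≢m) = inner-shift j _ (coordOf m t (suc i)) (- d) ¬end (begin
      coordOf m (bump t i d) (suc i)        ≡⟨ coordOf-inner m (bump t i d) i i≢m ⟩
      bump t i d (suc i) - bump t i d i     ≡⟨ cong₂ _-_ (bump-off t i d (suc i) (ℕP.<⇒≢ (ℕP.n<1+n i) ∘ sym))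
                                                         (bump-at t i d) ⟩
      t (suc i) - (t i + d)                 ≡⟨ regroup (t (suc i)) (t i) d ⟩
      (t (suc i) - t i) + - d               ≡⟨ cong (_+ - d) (sym (coordOf-inner m t i i≢m)) ⟩
      coordOf m t (suc i) + - d             ∎)
      where
      ¬end : ¬ IsEnd j
      ¬end (inj₁ j≡0)    with trans (sym j≡1+i) j≡0
      ... | ()
      ¬end (inj₂ j≡last) = i≢m (ℕP.suc-injective (trans (sym j≡1+i) j≡last))

  bump-shift-off : ∀ m t i d c → c ≢ i → c ≢ suc i → coordOf m (bump t i d) c ≡ coordOf m t c
  bump-shift-off m t i d zero    c≢i _     = cong residue (bump-off t i d 0 c≢i)
  bump-shift-off m t i d (suc k) c≢i c≢1+i = by-position (k ℕ.≟ m)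
    where
    k≢i : k ≢ i
    k≢i = c≢1+i ∘ cong suc
    by-position : Dec (k ≡ m) → coordOf m (bump t i d) (suc k) ≡ coordOf m t (suc k)
    by-position (yes refl) = trans (coordOf-last k (bump t i d))
      (trans (cong (λ x → residue (- x)) (bump-off t i d k k≢i)) (sym (coordOf-last k t)))
    by-position (no k≢m) = trans (coordOf-inner m (bump t i d) k k≢m)
      (trans (cong₂ _-_ (bump-off t i d (suc k) c≢i) (bump-off t i d k k≢i)) (sym (coordOf-inner m t k k≢m)))

  module _ (m : ℕ) (t : ℕ → ℤ) (i : Fin (suc m)) (d : ℤ) where

    private
      u v : Tuple m
      u = vertexOf m (bump t (toℕ i) d)
      v = vertexOf m t

      i≤m : toℕ i ℕ.≤ m
      i≤m = ℕP.≤-pred (FinP.toℕ<n i)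

    lookup-bump-at : CoordShift n (inject₁ i) (lookup u (inject₁ i)) (lookup v (inject₁ i)) d
    lookup-bump-at =
      subst₂ (λ a b → CoordShift n (inject₁ i) a b d)
        (sym (trans (lookup-vertexOf m _ (inject₁ i)) (cong (coordOf m _) (FinP.toℕ-inject₁ i))))
        (sym (trans (lookup-vertexOf m t (inject₁ i)) (cong (coordOf m t) (FinP.toℕ-inject₁ i))))
        (bump-shift-at m t (toℕ i) d i≤m (inject₁ i) (FinP.toℕ-inject₁ i))

    lookup-bump-after : CoordShift n (suc i) (lookup u (suc i)) (lookup v (suc i)) (- d)
    lookup-bump-after =
      subst₂ (λ a b → CoordShift n (suc i) a b (- d))
        (sym (lookup-vertexOf m _ (suc i))) (sym (lookup-vertexOf m t (suc i)))
        (bump-shift-after m t (toℕ i) d i≤m (suc i) refl)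

    lookup-bump-off : ∀ j → ¬ j ≡ inject₁ i → ¬ j ≡ suc i → lookup u j ≡ lookup v j
    lookup-bump-off j j≢i j≢1+i = begin
      lookup u j                         ≡⟨ lookup-vertexOf m _ j ⟩
      coordOf m (bump t (toℕ i) d) (toℕ j) ≡⟨ bump-shift-off m t (toℕ i) d (toℕ j)
          (λ j≡i → j≢i (FinP.toℕ-injective (trans j≡i (sym (FinP.toℕ-inject₁ i)))))
          (λ j≡1+i → j≢1+i (FinP.toℕ-injective j≡1+i)) ⟩
      coordOf m t (toℕ j)                ≡⟨ lookup-vertexOf m t j ⟨
      lookup v j                         ∎
      where open ≡-Reasoning

  bump-adjacent : ∀ m t i d → i ℕ.≤ m → IsUnit d →
                  Adj n m (vertexOf m (bump t i d)) (vertexOf m t)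
  bump-adjacent m t i d i≤m unit =
    subst (λ k → Adj n m (vertexOf m (bump t k d)) (vertexOf m t)) (FinP.toℕ-fromℕ< (s≤s i≤m))
          (adjacent (fromℕ< (s≤s i≤m)) unit)
    where
    adjacent : ∀ (i : Fin (suc m)) → IsUnit d → Adj n m (vertexOf m (bump t (toℕ i) d)) (vertexOf m t)
    adjacent i (inj₁ refl) = i , lookup-bump-off m t i d , inj₁ (lookup-bump-at m t i d , lookup-bump-after m t i d)
    adjacent i (inj₂ refl) = i , lookup-bump-off m t i d , inj₂ (lookup-bump-at m t i d , lookup-bump-after m t i d)

  snoc-walk : ∀ {m x y z k} → Walk n m x y k → Valid n m z → Adj n m y z → Walk n m x z (suc k)
  snoc-walk nil            valid-z y~z = cons valid-z y~z nil
  snoc-walk (cons vy x~y w) valid-z y~z = cons vy x~y (snoc-walk w valid-z y~z)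

  -- Upper bound on distances: the vertex of a Lipschitz height function t is reached from
  -- the zero vertex in weight m t steps, by undoing the moves of `descend` one at a time.
  walk-from-zero : ∀ m k t → Lipschitz m t → weight m t ≡ k → Walk n m (zeroT m) (vertexOf m t) k
  walk-from-zero m zero t lip weight≡0 = subst (λ v → Walk n m (zeroT m) v 0) zero≡ nil
    where
    zero≡ : zeroT m ≡ vertexOf m t
    zero≡ = trans (sym (vertexOf-zero m)) (vertexOf-cong m λ j j≤m →
              sym (ℤP.∣i∣≡0⇒i≡0 (sumℕ-zero⁻¹ (suc m) (λ j → ∣ t j ∣) weight≡0 j (s≤s j≤m))))
  walk-from-zero m (suc k) t lip weight≡ with descend m t k lip weight≡
  ... | i , d , i≤m , unit , lip' , weight'≡ =
    snoc-walk (walk-from-zero m k (bump t i d) lip' weight'≡) (vertexOf-valid m t lip) (bump-adjacent m t i d i≤m unit)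

  shift-cancel : ∀ {m} (j : Fin (suc (suc m))) x y w e → CoordShift n j x y e → CoordShift n j w x (- e) →
                 (IsEnd j → InRange w × InRange y) → w ≡ y
  shift-cancel j x y w e (inj₁ (end , n∣x-[y+e])) (inj₁ (_ , n∣w-[x-e])) ranges =
    let ((w≥0 , w<n) , (y≥0 , y<n)) = ranges end in
    residues-unique w≥0 w<n y≥0 y<n
      (subst (N ∣_) (regroup w x y e) (∣m∣n⇒∣m+n {N} {w - (x + - e)} {x - (y + e)} (∣ᵤ⇒∣ n∣w-[x-e]) (∣ᵤ⇒∣ n∣x-[y+e])))
    where
    regroup : ∀ w x y e → (w - (x + - e)) + (x - (y + e)) ≡ w - y
    regroup = solve-∀
  shift-cancel j x y w e (inj₁ (end , _))  (inj₂ (¬end , _)) _ = ⊥-elim (¬end end)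
  shift-cancel j x y w e (inj₂ (¬end , _)) (inj₁ (end , _))  _ = ⊥-elim (¬end end)
  shift-cancel j x y w e (inj₂ (_ , x≡y+e)) (inj₂ (_ , w≡x-e)) _ =
    trans w≡x-e (trans (cong (_+ - e) x≡y+e) (cancel y e))
    where
    cancel : ∀ y e → (y + e) + - e ≡ y
    cancel = solve-∀

  vec-ext : ∀ {k} (u v : Vec ℤ k) → (∀ j → lookup u j ≡ lookup v j) → u ≡ v
  vec-ext u v u≗v = trans (sym (VecP.tabulate∘lookup u)) (trans (VecP.tabulate-cong u≗v) (VecP.tabulate∘lookup v))

  step-back-by : ∀ m t y (i : Fin (suc m)) e → ∣ e ∣ ≡ 1 →
    (∀ j → ¬ j ≡ inject₁ i → ¬ j ≡ suc i → lookup (vertexOf m t) j ≡ lookup y j) →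
    CoordShift n (inject₁ i) (lookup (vertexOf m t) (inject₁ i)) (lookup y (inject₁ i)) e →
    CoordShift n (suc i) (lookup (vertexOf m t) (suc i)) (lookup y (suc i)) (- e) →
    Valid n m y → ∃ λ t' → vertexOf m t' ≡ y × weight m t' ℕ.≤ suc (weight m t)
  step-back-by m t y i e ∣e∣≡1 unchanged at after valid-y =
    t' , vec-ext _ y same , weight-bump≤ m t (toℕ i) (- e) (ℕP.≤-pred (FinP.toℕ<n i)) (trans (ℤP.∣-i∣≡∣i∣ e) ∣e∣≡1)
    where
    t' = bump t (toℕ i) (- e)
    ranges : ∀ j → IsEnd j → InRange (lookup (vertexOf m t') j) × InRange (lookup y j)
    ranges j end = vertexOf-ends m t' j end , proj₁ valid-y j end
    same : ∀ j → lookup (vertexOf m t') j ≡ lookup y j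
    same j with j FinP.≟ inject₁ i
    ... | yes refl = shift-cancel j _ _ _ e at (lookup-bump-at m t i (- e)) (ranges j)
    ... | no  j≢i with j FinP.≟ suc i
    ...   | yes refl = shift-cancel j _ _ _ (- e) after (lookup-bump-after m t i (- e)) (ranges j)
    ...   | no  j≢1+i = trans (lookup-bump-off m t i (- e) j j≢i j≢1+i) (unchanged j j≢i j≢1+i)

  step-back : ∀ m t y → Adj n m (vertexOf m t) y → Valid n m y →
              ∃ λ t' → vertexOf m t' ≡ y × weight m t' ℕ.≤ suc (weight m t)
  step-back m t y (i , unchanged , inj₁ (at , after)) = step-back-by m t y i (+ 1)   refl unchanged at after
  step-back m t y (i , unchanged , inj₂ (at , after)) = step-back-by m t y i (- + 1) refl unchanged at after

  walk-weight : ∀ {m x z k} → Walk n m x z k → ∀ t → vertexOf m t ≡ x →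
                ∃ λ t' → vertexOf m t' ≡ z × weight m t' ℕ.≤ weight m t ℕ.+ k
  walk-weight nil t refl = t , refl , ℕP.m≤m+n _ 0
  walk-weight {m} {k = suc k} (cons {y = y} valid-y x~y w) t refl with step-back m t y x~y valid-y
  ... | t₁ , refl , weight₁≤ with walk-weight w t₁ refl
  ...   | t₂ , z≡ , weight₂≤ =
    t₂ , z≡ , ℕP.≤-trans weight₂≤ (ℕP.≤-trans (ℕP.+-monoˡ-≤ k weight₁≤) (ℕP.≤-reflexive (sym (ℕP.+-suc (weight m t) k))))

  walk-weight-from-zero : ∀ {m y k} → Walk n m (zeroT m) y k → ∃ λ t' → vertexOf m t' ≡ y × weight m t' ℕ.≤ k
  walk-weight-from-zero {m} {y} {k} w with walk-weight w (λ _ → + 0) (vertexOf-zero m)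
  ... | t' , y≡ , weight≤ = t' , y≡ , subst (λ x → weight m t' ℕ.≤ x ℕ.+ k) (sumℕ-zero (suc m) _ (λ _ _ → refl)) weight≤

  prefix : ∀ {m} → Tuple m → ℕ → ℤ
  prefix y j = sumℤ (λ k → entry y (suc k)) j

  lift : ∀ {m} → Tuple m → ℤ → ℕ → ℤ
  lift y c j = c + prefix y j

  prefix-suc : ∀ {m} (y : Tuple m) k → prefix y (suc k) ≡ prefix y k + entry y (suc k)
  prefix-suc y k = sumℤ-snoc k (λ k → entry y (suc k))

  lift-step : ∀ {m} (y : Tuple m) c k → lift y c (suc k) - lift y c k ≡ entry y (suc k)
  lift-step y c k = trans (cong (λ x → (c + x) - (c + prefix y k)) (prefix-suc y k)) (cancel c (prefix y k) (entry y (suc k)))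
    where
    cancel : ∀ c p a → (c + (p + a)) - (c + p) ≡ a
    cancel = solve-∀

  entry-lookup< : ∀ {m} (y : Tuple m) c (c< : c ℕ.< suc (suc m)) → entry y c ≡ lookup y (fromℕ< c<)
  entry-lookup< y c c< = trans (cong (entry y) (sym (FinP.toℕ-fromℕ< c<))) (entry-lookup y (fromℕ< c<))

  lift-lipschitz : ∀ m (y : Tuple m) c → Valid n m y → Lipschitz m (lift y c)
  lift-lipschitz m y c (_ , inner , _) k k<m =
    subst (λ x → ∣ x ∣ ℕ.≤ 1) (sym (trans (lift-step y c k) (entry-lookup< y (suc k) k+1<)))
          (bounds⇒abs≤1 _ (proj₁ (inner _ ¬end)) (proj₂ (inner _ ¬end)))
    where
    k+1< : suc k ℕ.< suc (suc m)
    k+1< = s≤s (s≤s (ℕP.<⇒≤ k<m))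
    ¬end : ¬ IsEnd (fromℕ< k+1<)
    ¬end (inj₁ k+1≡0)    with trans (sym (FinP.toℕ-fromℕ< k+1<)) k+1≡0
    ... | ()
    ¬end (inj₂ k+1≡last) = ℕP.<-irrefl (ℕP.suc-injective (trans (sym (FinP.toℕ-fromℕ< k+1<)) k+1≡last)) k<m

  heights-are-lifts : ∀ m t (y : Tuple m) → vertexOf m t ≡ y →
                      N ∣ (t 0 - entry y 0) × (∀ j → j ℕ.≤ m → t j ≡ lift y (t 0) j)
  heights-are-lifts m t y refl = start , agree
    where
    coord≡entry : ∀ c → c ℕ.< suc (suc m) → coordOf m t c ≡ entry y c
    coord≡entry c c< = sym (trans (entry-lookup< y c c<)
                         (trans (lookup-vertexOf m t (fromℕ< c<)) (cong (coordOf m t) (FinP.toℕ-fromℕ< c<))))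
    start : N ∣ (t 0 - entry y 0)
    start = subst (N ∣_) (regroup (t 0) (entry y 0) (residue (t 0)) (coord≡entry 0 (s≤s z≤n)))
                  (∣m⇒∣-m (residue-congruent (t 0)))
      where
      regroup : ∀ x y r → r ≡ y → - (r - x) ≡ x - y
      regroup x y r refl = negate-diff x y
        where negate-diff : ∀ x y → - (y - x) ≡ x - y
              negate-diff = solve-∀
    agree : ∀ j → j ℕ.≤ m → t j ≡ lift y (t 0) j
    agree zero    _     = sym (ℤP.+-identityʳ (t 0))
    agree (suc k) k+1≤m = begin
      t (suc k)                                    ≡⟨ b≡a+[b-a] (t k) (t (suc k)) ⟩
      t k + (t (suc k) - t k)                      ≡⟨ cong₂ _+_ (agree k (ℕP.<⇒≤ k+1≤m)) step ⟩
      lift y (t 0) k + entry y (suc k)             ≡⟨ cong (_+_ (lift y (t 0) k)) (lift-step y (t 0) k) ⟨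
      lift y (t 0) k + (lift y (t 0) (suc k) - lift y (t 0) k) ≡⟨ b≡a+[b-a] (lift y (t 0) k) _ ⟨
      lift y (t 0) (suc k)                         ∎
      where
      open ≡-Reasoning
      step : t (suc k) - t k ≡ entry y (suc k)
      step = trans (sym (coordOf-inner m t k (ℕP.<⇒≢ k+1≤m))) (coord≡entry (suc k) (s≤s (s≤s (ℕP.<⇒≤ k+1≤m))))

  vertexOf-lift : ∀ m (y : Tuple m) c → Valid n m y → N ∣ (c - entry y 0) → vertexOf m (lift y c) ≡ y
  vertexOf-lift m y c (ends , _ , n∣sum) n∣c-y₀ =
    vec-ext _ y λ j → trans (lookup-vertexOf m _ j) (trans (coords (toℕ j) (FinP.toℕ<n j)) (entry-lookup y j))
    where
    end-range : ∀ c' (c'< : c' ℕ.< suc (suc m)) → IsEnd (fromℕ< c'<) → InRange (entry y c')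
    end-range c' c'< end = subst InRange (sym (entry-lookup< y c' c'<)) (ends (fromℕ< c'<) end)
    first-range : InRange (entry y 0)
    first-range = end-range 0 (s≤s z≤n) (inj₁ refl)
    last-range : InRange (entry y (suc m))
    last-range = end-range (suc m) ℕP.≤-refl (inj₂ (FinP.toℕ-fromℕ< ℕP.≤-refl))
    n∣total : N ∣ (entry y 0 + (prefix y m + entry y (suc m)))
    n∣total = subst (N ∣_) (trans (ℤP.+-identityʳ _)
                              (trans (sumV-entry y) (cong (_+_ (entry y 0)) (sumℤ-snoc m (λ k → entry y (suc k))))))
                    (∣ᵤ⇒∣ n∣sum)
    coords : ∀ c' → c' ℕ.< suc (suc m) → coordOf m (lift y c) c' ≡ entry y c'
    coords zero _ = residues-unique (residue-≥0 (c + + 0)) (residue-<n (c + + 0)) (proj₁ first-range) (proj₂ first-range)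
      (subst (N ∣_) (regroup (residue (c + + 0)) c (entry y 0)) (∣m∣n⇒∣m+n (residue-congruent (c + + 0)) n∣c-y₀))
      where
      regroup : ∀ r c y₀ → (r - (c + + 0)) + (c - y₀) ≡ r - y₀
      regroup = solve-∀
    coords (suc k) (s≤s (s≤s k≤m)) = by-position (k ℕ.≟ m)
      where
      by-position : Dec (k ≡ m) → coordOf m (lift y c) (suc k) ≡ entry y (suc k)
      by-position (yes refl) = trans (coordOf-last k (lift y c))
        (residues-unique (residue-≥0 (- lift y c k)) (residue-<n (- lift y c k)) (proj₁ last-range) (proj₂ last-range)
          (subst (N ∣_) (regroup (residue (- lift y c k)) c (prefix y k) (entry y 0) (entry y (suc k)))
            (∣m∣n⇒∣m-n (residue-congruent (- lift y c k)) (∣m∣n⇒∣m+n n∣c-y₀ n∣total))))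
        where
        regroup : ∀ r c p y₀ yₗ → (r - - (c + p)) - ((c - y₀) + (y₀ + (p + yₗ))) ≡ r - yₗ
        regroup = solve-∀
      by-position (no k≢m) = trans (coordOf-inner m (lift y c) k k≢m) (lift-step y c k)

  distance : ∀ m (y : Tuple m) → Valid n m y →
             ∃ λ d → Dist n m (zeroT m) y d × (∀ c → N ∣ (c - entry y 0) → d ℕ.≤ weight m (lift y c))
  distance m y valid-y with minimise (λ c → N ∣? (c - entry y 0)) cost ∣c∣≤cost (entry y 0) (n∣x-x (entry y 0))
    where
    cost : ℤ → ℕ
    cost c = weight m (lift y c)
    ∣c∣≤cost : ∀ c → ∣ c ∣ ℕ.≤ cost c
    ∣c∣≤cost c = subst (ℕ._≤ cost c) (cong ∣_∣ (ℤP.+-identityʳ c)) (∣head∣≤weight m (lift y c))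
    n∣x-x : ∀ x → N ∣ (x - x)
    n∣x-x x = subst (N ∣_) (sym (ℤP.+-inverseʳ x)) (divides (+ 0) refl)
  ... | c , n∣c-y₀ , minimal = weight m (lift y c) , (reach , shortest) , minimal
    where
    reach : Walk n m (zeroT m) y (weight m (lift y c))
    reach = subst (λ v → Walk n m (zeroT m) v (weight m (lift y c))) (vertexOf-lift m y c valid-y n∣c-y₀)
                  (walk-from-zero m _ (lift y c) (lift-lipschitz m y c valid-y) refl)
    shortest : ∀ k → Walk n m (zeroT m) y k → weight m (lift y c) ℕ.≤ k
    shortest k w with walk-weight-from-zero w
    ... | t , t↦y , weight≤k with heights-are-lifts m t y t↦y
    ...   | n∣t₀-y₀ , t≗lift = ℕP.≤-trans (minimal (t 0) n∣t₀-y₀)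
                                         (ℕP.≤-trans (ℕP.≤-reflexive (sym (weight-cong m t≗lift))) weight≤k)

  -- The claimed eccentricity ⌊n (m + 1) / 2⌋, kept opaque so that it is never normalised.
  opaque
    target : ℕ → ℕ
    target m = (n ℕ.* (m ℕ.+ 1)) ℕ./ 2

    target-definition : ∀ m → target m ≡ (n ℕ.* (m ℕ.+ 1)) ℕ./ 2
    target-definition m = refl

  ≤target : ∀ m x → x ℕ.* 2 ℕ.≤ n ℕ.* (m ℕ.+ 1) → x ℕ.≤ target m
  ≤target m x x*2≤ = subst (x ℕ.≤_) (sym (target-definition m)) (≤half x _ x*2≤)

  near-zero-target : ∀ m s → m ℕ.≤ n → Lipschitz m s → ∀ i → i ℕ.≤ m → s i ≡ + 0 → weight m s ℕ.≤ target m
  near-zero-target m s m≤n lip i i≤m sᵢ≡0 = ≤target m (weight m s) (begin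
    weight m s ℕ.* 2   ≤⟨ weight-near-zero m s lip i i≤m sᵢ≡0 ⟩
    m ℕ.* suc m        ≤⟨ ℕP.*-monoˡ-≤ (suc m) m≤n ⟩
    n ℕ.* suc m        ≡⟨ cong (n ℕ.*_) (ℕP.+-comm 1 m) ⟩
    n ℕ.* (m ℕ.+ 1)    ∎)
    where open ℕP.≤-Reasoning

  interval-pair : ∀ a → + 0 ≤ a → a ≤ N → ∣ a ∣ ℕ.+ ∣ a - N ∣ ≡ n
  interval-pair (+ a) _ (+≤+ a≤n) =
    trans (cong (a ℕ.+_) (trans (cong ∣_∣ (ℤP.[+m]-[+n]≡m⊖n a n)) (ℤP.∣⊖∣-≤ a≤n))) (ℕP.m+[n∸m]≡n a≤n)

  position-cases : ∀ m s → Lipschitz m s → + 0 ≤ s 0 → s 0 ≤ N →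
                   (∃ λ i → i ℕ.≤ m × s i ≡ + 0) ⊎ (∃ λ i → i ℕ.≤ m × s i ≡ N) ⊎
                   (∀ j → j ℕ.≤ m → (+ 0 ≤ s j) × (s j ≤ N))
  position-cases m s lip s₀≥0 s₀≤n with ℕP.anyUpTo? (λ j → s j ℤP.<? + 0) (suc m)
  ... | yes (j , j<1+m , sⱼ<0) = let (i , i≤j , sᵢ≡0) = ivt-down m s lip (+ 0) j (ℕP.≤-pred j<1+m) s₀≥0 (ℤP.<⇒≤ sⱼ<0) in
                                 inj₁ (i , ℕP.≤-trans i≤j (ℕP.≤-pred j<1+m) , sᵢ≡0)
  ... | no none-below with ℕP.anyUpTo? (λ j → N ℤP.<? s j) (suc m)
  ...   | yes (j , j<1+m , n<sⱼ) = let (i , i≤j , sᵢ≡n) = ivt-up m s lip N j (ℕP.≤-pred j<1+m) s₀≤n (ℤP.<⇒≤ n<sⱼ) in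
                                   inj₂ (inj₁ (i , ℕP.≤-trans i≤j (ℕP.≤-pred j<1+m) , sᵢ≡n))
  ...   | no none-above = inj₂ (inj₂ λ j j≤m →
          ℤP.≮⇒≥ (λ sⱼ<0 → none-below (j , s≤s j≤m , sⱼ<0)) , ℤP.≮⇒≥ (λ n<sⱼ → none-above (j , s≤s j≤m , n<sⱼ)))

  interval-weights : ∀ m s → (∀ j → j ℕ.≤ m → (+ 0 ≤ s j) × (s j ≤ N)) →
                     weight m s ℕ.+ weight m (λ j → s j - N) ≡ n ℕ.* (m ℕ.+ 1)
  interval-weights m s inside = begin
    weight m s ℕ.+ weight m (λ j → s j - N)      ≡⟨ sumℕ-+ (suc m) (λ j → ∣ s j ∣) (λ j → ∣ s j - N ∣) ⟨
    sumℕ (λ j → ∣ s j ∣ ℕ.+ ∣ s j - N ∣) (suc m) ≡⟨ sumℕ-cong (suc m) pair ⟩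
    sumℕ (λ _ → n) (suc m)                       ≡⟨ sumℕ-const (suc m) n ⟩
    suc m ℕ.* n                                   ≡⟨ ℕP.*-comm (suc m) n ⟩
    n ℕ.* suc m                                   ≡⟨ cong (n ℕ.*_) (ℕP.+-comm 1 m) ⟩
    n ℕ.* (m ℕ.+ 1)                               ∎
    where
    open ≡-Reasoning
    pair : ∀ j → j ℕ.< suc m → ∣ s j ∣ ℕ.+ ∣ s j - N ∣ ≡ n
    pair j j<1+m = let (s≥0 , s≤n) = inside j (ℕP.≤-pred j<1+m) in interval-pair (s j) s≥0 s≤n

  centred-bound : ∀ m s → m ℕ.≤ n → Lipschitz m s → + 0 ≤ s 0 → s 0 ≤ N →
                  weight m s ℕ.≤ target m ⊎ weight m (λ j → s j - N) ℕ.≤ target m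
  centred-bound m s m≤n lip s₀≥0 s₀≤n with position-cases m s lip s₀≥0 s₀≤n
  ... | inj₁ (i , i≤m , sᵢ≡0) = inj₁ (near-zero-target m s m≤n lip i i≤m sᵢ≡0)
  ... | inj₂ (inj₁ (i , i≤m , sᵢ≡n)) = inj₂ (near-zero-target m (λ j → s j - N) m≤n (shift-lipschitz m s N lip) i i≤m
                                               (trans (cong (_- N) sᵢ≡n) (ℤP.+-inverseʳ N)))
  ... | inj₂ (inj₂ inside) with smaller-half (weight m s) (weight m (λ j → s j - N)) _ (interval-weights m s inside)
  ...   | inj₁ s-small   = inj₁ (≤target m (weight m s) s-small)
  ...   | inj₂ s-n-small = inj₂ (≤target m (weight m (λ j → s j - N)) s-n-small)

  -- Upper bound: every Lipschitz t has a shift by a multiple of n of weight at most target m;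
  -- shift first so that t 0 becomes its residue, then possibly once more by n.
  shift-bound : ∀ m t → m ℕ.≤ n → Lipschitz m t → ∃ λ q → weight m (λ j → t j - q * N) ℕ.≤ target m
  shift-bound m t m≤n lip = choose (centred-bound m s m≤n (shift-lipschitz m t (q₀ * N) lip) s₀≥0 s₀≤n)
    where
    q₀ = t 0 ℤD./ℕ n
    s : ℕ → ℤ
    s j = t j - q₀ * N
    s₀≡ : s 0 ≡ residue (t 0)
    s₀≡ = trans (cong (_- q₀ * N) (residue-split (t 0))) (cancel (residue (t 0)) (q₀ * N))
      where cancel : ∀ a b → (a + b) - b ≡ a
            cancel = solve-∀
    s₀≥0 : + 0 ≤ s 0
    s₀≥0 = subst (+ 0 ≤_) (sym s₀≡) (residue-≥0 (t 0))
    s₀≤n : s 0 ≤ N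
    s₀≤n = subst (_≤ N) (sym s₀≡) (ℤP.<⇒≤ (residue-<n (t 0)))
    once-more : weight m (λ j → s j - N) ≡ weight m (λ j → t j - (q₀ + + 1) * N)
    once-more = weight-cong m (λ j _ → sym (distrib (t j) q₀ N))
      where distrib : ∀ x q k → x - (q + + 1) * k ≡ (x - q * k) - k
            distrib = solve-∀
    choose : weight m s ℕ.≤ target m ⊎ weight m (λ j → s j - N) ℕ.≤ target m →
             ∃ λ q → weight m (λ j → t j - q * N) ℕ.≤ target m
    choose (inj₁ s-small)   = q₀ , s-small
    choose (inj₂ s-n-small) = q₀ + + 1 , subst (ℕ._≤ target m) once-more s-n-small

  within-target : ∀ m → m ℕ.≤ n → ∀ y → Valid n m y → ∃ λ d → Dist n m (zeroT m) y d × d ℕ.≤ target m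
  within-target m m≤n y valid-y =
    let (d , dist , d≤lifts) = distance m y valid-y
        (q , small) = shift-bound m (lift y (entry y 0)) m≤n (lift-lipschitz m y (entry y 0) valid-y)
    in  d , dist , ℕP.≤-trans (d≤lifts (entry y 0 - q * N) (n∣shift q))
                     (ℕP.≤-trans (ℕP.≤-reflexive (weight-cong m (λ j _ → regroup (entry y 0) (q * N) (prefix y j)))) small)
    where
    n∣shift : ∀ q → N ∣ ((entry y 0 - q * N) - entry y 0)
    n∣shift q = subst (N ∣_) (sym (cancel (entry y 0) (q * N))) (∣m⇒∣-m (∣n⇒∣m*n q ∣-refl))
      where cancel : ∀ a b → (a - b) - a ≡ - b
            cancel = solve-∀
    regroup : ∀ a b p → (a - b) + p ≡ (a + p) - b
    regroup = solve-∀

  -- The far vertex is encoded by f j = h + r · parity j, where n = 2h + r and r ≤ 1; its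
  -- values alternate between h and h + r, and its shift by -n alternates between -(h + r) and -h.
  opaque
    h r : ℕ
    h = n ℕ./ 2
    r = n ℕ.% 2

    r≤1 : r ℕ.≤ 1
    r≤1 = ℕP.≤-pred (ℕD.m%n<n n 2)

    n≡r+2h : n ≡ r ℕ.+ h ℕ.* 2
    n≡r+2h = ℕD.m≡m%n+[m/n]*n n 2

  farValue : (ℕ → ℕ) → ℕ → ℕ
  farValue w j = h ℕ.+ r ℕ.* w j

  far : ℕ → ℤ
  far j = + farValue parity j

  far-lipschitz : ∀ m → Lipschitz m far
  far-lipschitz m j _ = begin
    ∣ far (suc j) - far j ∣                      ≡⟨ cong ∣_∣ (ℤP.[+m]-[+n]≡m⊖n (farValue parity (suc j)) (farValue parity j)) ⟩
    ∣ farValue parity (suc j) ℤ.⊖ farValue parity j ∣ ≡⟨ cong ∣_∣ (ℤP.+-cancelˡ-⊖ h (r ℕ.* parity (suc j)) (r ℕ.* parity j)) ⟩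
    ∣ r ℕ.* parity (suc j) ℤ.⊖ r ℕ.* parity j ∣ ≤⟨ ℤP.∣m⊝n∣≤m⊔n (r ℕ.* parity (suc j)) (r ℕ.* parity j) ⟩
    r ℕ.* parity (suc j) ℕ.⊔ r ℕ.* parity j    ≤⟨ ℕP.⊔-lub (ℕP.*-mono-≤ r≤1 (parity≤1 (suc j))) (ℕP.*-mono-≤ r≤1 (parity≤1 j)) ⟩
    1                                           ∎
    where open ℕP.≤-Reasoning

  far-complement : ∀ j → n ≡ farValue parity j ℕ.+ farValue parity (suc j)
  far-complement j = begin
    n                                                        ≡⟨ n≡r+2h ⟩
    r ℕ.+ h ℕ.* 2                                            ≡⟨ cong (ℕ._+ h ℕ.* 2) r≡ ⟩
    r ℕ.* (parity j ℕ.+ parity (suc j)) ℕ.+ h ℕ.* 2        ≡⟨ regroup h r (parity j) (parity (suc j)) ⟩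
    farValue parity j ℕ.+ farValue parity (suc j)            ∎
    where
    open ≡-Reasoning
    r≡ : r ≡ r ℕ.* (parity j ℕ.+ parity (suc j))
    r≡ = trans (sym (ℕP.*-identityʳ r)) (cong (r ℕ.*_) (sym (parity-alternating j)))
    regroup : ∀ h r a b → r ℕ.* (a ℕ.+ b) ℕ.+ h ℕ.* 2 ≡ (h ℕ.+ r ℕ.* a) ℕ.+ (h ℕ.+ r ℕ.* b)
    regroup = ℕSolver.solve-∀

  target≤farValues : ∀ m w → Alternating w → target m ℕ.≤ sumℕ (farValue w) (suc m)
  target≤farValues m w alt = subst (ℕ._≤ total) (sym (target-definition m)) (half≤ (n ℕ.* (m ℕ.+ 1)) total (begin
    n ℕ.* (m ℕ.+ 1)                       ≡⟨ cong (ℕ._* (m ℕ.+ 1)) n≡r+2h ⟩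
    (r ℕ.+ h ℕ.* 2) ℕ.* (m ℕ.+ 1)         ≡⟨ expand r h m ⟩
    r ℕ.* suc m ℕ.+ suc m ℕ.* h ℕ.* 2     ≤⟨ ℕP.+-monoˡ-≤ _ (ℕP.*-monoʳ-≤ r (alternating-count w alt (suc m))) ⟩
    r ℕ.* suc (ones ℕ.* 2) ℕ.+ suc m ℕ.* h ℕ.* 2 ≡⟨ collect r ones (suc m ℕ.* h) ⟩
    r ℕ.+ (suc m ℕ.* h ℕ.+ r ℕ.* ones) ℕ.* 2 ≡⟨ cong (λ x → r ℕ.+ x ℕ.* 2) total≡ ⟨
    r ℕ.+ total ℕ.* 2                     ≤⟨ ℕP.+-monoˡ-≤ _ r≤1 ⟩
    suc (total ℕ.* 2)                     ∎))
    where
    open ℕP.≤-Reasoning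
    ones = sumℕ w (suc m)
    total = sumℕ (farValue w) (suc m)
    expand : ∀ r h m → (r ℕ.+ h ℕ.* 2) ℕ.* (m ℕ.+ 1) ≡ r ℕ.* suc m ℕ.+ suc m ℕ.* h ℕ.* 2
    expand = ℕSolver.solve-∀
    total≡ : total ≡ suc m ℕ.* h ℕ.+ r ℕ.* ones
    total≡ = trans (sumℕ-+ (suc m) (λ _ → h) (λ j → r ℕ.* w j))
                   (cong₂ ℕ._+_ (sumℕ-const (suc m) h) (sumℕ-scale (suc m) r w))
    collect : ∀ r W X → r ℕ.* suc (W ℕ.* 2) ℕ.+ X ℕ.* 2 ≡ r ℕ.+ (X ℕ.+ r ℕ.* W) ℕ.* 2
    collect = ℕSolver.solve-∀


  -- Every shift of the far height function by a multiple of n has weight at least target m: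
  -- a nonnegative shift leaves all values ≥ h + r · parity j, a negative one makes them
  -- ≤ -(h + r · parity (j + 1)).
  far-shift-weight : ∀ m t q → (∀ j → j ℕ.≤ m → t j ≡ far j + q * N) → target m ℕ.≤ weight m t
  far-shift-weight m t (+ a) t≡ = ℕP.≤-trans (target≤farValues m parity parity-alternating)
    (sumℕ-mono (suc m) λ j j<1+m → ≤∣∣-pos (farValue parity j) (t j)
      (subst (+ farValue parity j ≤_) (sym (trans (t≡ j (ℕP.≤-pred j<1+m)) (cong (_+_ (far j)) (sym (ℤP.pos-* a n)))))
             (+≤+ (ℕP.m≤m+n (farValue parity j) (a ℕ.* n)))))
  far-shift-weight m t -[1+ a ] t≡ = ℕP.≤-trans (target≤farValues m (λ j → parity (suc j)) (λ j → parity-alternating (suc j)))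
    (sumℕ-mono (suc m) λ j j<1+m → ≤∣∣-neg (farValue parity (suc j)) (t j) (begin
      t j                             ≡⟨ t≡ j (ℕP.≤-pred j<1+m) ⟩
      far j + -[1+ a ] * N            ≤⟨ ℤP.+-monoʳ-≤ (far j) (-≤- (ℕP.m≤m+n n-1 (a ℕ.* n))) ⟩
      far j - N                       ≡⟨ cong (λ x → far j - x) (trans (cong +_ (far-complement j)) (ℤP.pos-+ (farValue parity j) (farValue parity (suc j)))) ⟩
      far j - (far j + far (suc j))   ≡⟨ a-[a+d]≡-d (far j) (far (suc j)) ⟩
      - far (suc j)                   ∎))
    where open ℤP.≤-Reasoning

  far-vertex-distance : ∀ m k → Walk n m (zeroT m) (vertexOf m far) k → target m ℕ.≤ k
  far-vertex-distance m k w =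
    let (t , t↦far , weight≤k)       = walk-weight-from-zero w
        (n∣t₀-y₀ , t≗lift)           = heights-are-lifts m t y t↦far
        (n∣f₀-y₀ , far≗lift)         = heights-are-lifts m far y refl
        divides q t₀-f₀≡             = subst (N ∣_) (difference (t 0) (far 0) (entry y 0)) (∣m∣n⇒∣m-n n∣t₀-y₀ n∣f₀-y₀)
    in  ℕP.≤-trans (far-shift-weight m t q λ j j≤m →
          trans (t≗lift j j≤m) (trans (same-prefix (t 0) (far 0) (prefix y j))
            (cong₂ _+_ (sym (far≗lift j j≤m)) t₀-f₀≡))) weight≤k
    where
    y = vertexOf m far
    difference : ∀ a b c → (a - c) - (b - c) ≡ a - b
    difference = solve-∀
    same-prefix : ∀ a b p → a + p ≡ (b + p) + (a - b)
    same-prefix = solve-∀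

  eccentricity : ∀ m → m ℕ.≤ n → Ecc n m (zeroT m) (target m)
  eccentricity m m≤n = within-target m m≤n , vertexOf m far , far-valid , far-dist
    where
    far-valid : Valid n m (vertexOf m far)
    far-valid = vertexOf-valid m far (far-lipschitz m)
    far-dist : Dist n m (zeroT m) (vertexOf m far) (target m)
    far-dist =
      let (d , (walk , _) , d≤target) = within-target m m≤n (vertexOf m far) far-valid
      in  subst (Walk n m (zeroT m) (vertexOf m far)) (ℕP.≤-antisym d≤target (far-vertex-distance m d walk)) walk ,
          far-vertex-distance m

-- Theorem 5.17: ecc(0) = ⌊n (m + 1) / 2⌋ in Z_{n,m}; only n ≥ 1 and m ≤ n are used.
theorem5p17 : (n m : ℕ) → 2 ℕ.≤ n → 1 ℕ.≤ m → m ℕ.≤ n →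
    Ecc n m (zeroT m) ((n ℕ.* (m ℕ.+ 1)) ℕ./ 2)
theorem5p17 (suc n-1) m _ _ m≤n =
  subst (Ecc (suc n-1) m (zeroT m)) (DYoke.target-definition n-1 m) (DYoke.eccentricity n-1 m m≤n)
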